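{- Let $u_1,\ldots,u_n,v_1,\ldots,v_n\in\mathcal{M}$. Then $\phi(u_1)\otimes\cdots\otimes\phi(u_n)=\phi(v_1)\otimes\cdots\otimes\phi(v_n)$ in $\mathcal{W}^{\otimes n}$ if and only if $\phi(u_i)=\phi(v_i)$ for each $i\in\{1,\ldots,n\}$.
   Context: $\Bbbk$ is a field of characteristic $0$; $\mathcal{M}$ is the free monoid on letters $D,U$; $\mathcal{W}=\Bbbk\langle D,U\mid DU-UD=1\rangle$ is the Weyl algebra; $\phi:\mathcal{M}\to\mathcal{W}$ is the monoid morphism $D\mapsto D,U\mapsto U$; tensor products are over $\Bbbk$. -}

module Defs where

open import Level using (Level; _⊔_) renaming (suc to lsuc)
open import Algebra.Bundles using (CommutativeRing)
open import Data.Nat using (ℕ; zero; suc)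
open import Data.List using (List; []; _∷_; _++_)
open import Data.Vec using (Vec; _[_]≔_)
open import Data.Fin using (Fin)
open import Data.Product using (Σ; _×_; _,_)
open import Relation.Nullary using (¬_)

-- The free monoid 𝓜 on the letters D, U (words, with concatenation _++_).

data Letter : Set where
  D U : Letter

Word : Set
Word = List Letter

fromℕ : ∀ {c ℓ} (R : CommutativeRing c ℓ) → ℕ → CommutativeRing.Carrier R
fromℕ R zero    = CommutativeRing.0# R
fromℕ R (suc m) = CommutativeRing._+_ R (CommutativeRing.1# R) (fromℕ R m)

record Field (c ℓ : Level) : Set (lsuc (c ⊔ ℓ)) where
  field
    commutativeRing : CommutativeRing c ℓ
  open CommutativeRing commutativeRing public
  field
    0≉1     : ¬ (0# ≈ 1#)
    inverse : ∀ x → ¬ (x ≈ 0#) → Σ Carrier (λ y → x * y ≈ 1#)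
    char0   : ∀ m → ¬ (fromℕ commutativeRing (suc m) ≈ 0#)

-- A k-module presented by a basis B modulo relations of the shape
--   b = b₁ + b₂   (one for each inhabitant of R b b₁ b₂).
-- Elements are finite formal k-linear combinations (lists of
-- coefficient/basis pairs); _≋_ is the smallest equivalence relation
-- compatible with the k-module structure identifying formal combinations
-- equal in the free module k[B] and imposing the relations.

module Presented {c ℓ b r} (K : Field c ℓ) (B : Set b)
                 (R : B → B → B → Set r) where
  open Field K

  Comb : Set (c ⊔ b)
  Comb = List (Carrier × B)

  infix 4 _≋_
  data _≋_ : Comb → Comb → Set (c ⊔ ℓ ⊔ b ⊔ r) where
    ≋-refl  : ∀ {x} → x ≋ x
    ≋-sym   : ∀ {x y} → x ≋ y → y ≋ x
    ≋-trans : ∀ {x y z} → x ≋ y → y ≋ z → x ≋ z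
    ++-cong : ∀ {x x′ y y′} → x ≋ x′ → y ≋ y′ → x ++ y ≋ x′ ++ y′
    swap    : ∀ {a a′ t t′ xs} →
              (a , t) ∷ (a′ , t′) ∷ xs ≋ (a′ , t′) ∷ (a , t) ∷ xs
    merge   : ∀ {a a′ t xs} → (a , t) ∷ (a′ , t) ∷ xs ≋ (a + a′ , t) ∷ xs
    zero-c  : ∀ {t xs} → (0# , t) ∷ xs ≋ xs
    coeff   : ∀ {a a′ t xs} → a ≈ a′ → (a , t) ∷ xs ≋ (a′ , t) ∷ xs
    rel     : ∀ {a t t₁ t₂ xs} → R t t₁ t₂ →
              (a , t) ∷ xs ≋ (a , t₁) ∷ (a , t₂) ∷ xs

-- The Weyl algebra 𝓦 = k⟨D,U | DU − UD = 1⟩ as the free k-module k[𝓜]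
-- (= free algebra k⟨D,U⟩) modulo the two-sided ideal generated by
-- DU − UD − 1, which is spanned by  p (DU − UD − 1) q  for words p, q.

data WeylStep : Word → Word → Word → Set where
  step : ∀ p q → WeylStep (p ++ D ∷ U ∷ q) (p ++ U ∷ D ∷ q) (p ++ q)

module _ {c ℓ} (K : Field c ℓ) where
  open Field K
  private module PW = Presented K Word WeylStep

  𝓦 : Set c
  𝓦 = PW.Comb

  infix 4 _≈𝓦_
  _≈𝓦_ : 𝓦 → 𝓦 → Set (c ⊔ ℓ)
  _≈𝓦_ = PW._≋_

  φ : Word → 𝓦
  φ u = (1# , u) ∷ []

-- 𝓦^{⊗n}: since k⟨D,U⟩ is free on 𝓜, k⟨D,U⟩^{⊗n} is free on 𝓜ⁿ, and
-- 𝓦^{⊗n} is its quotient by the subspace spanned by the tensors having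
-- a generator p (DU − UD − 1) q of the ideal in some slot i.

data TensorStep (n : ℕ) : Vec Word n → Vec Word n → Vec Word n → Set where
  slot : ∀ (t : Vec Word n) (i : Fin n) {w w₁ w₂} → WeylStep w w₁ w₂ →
         TensorStep n (t [ i ]≔ w) (t [ i ]≔ w₁) (t [ i ]≔ w₂)

module _ {c ℓ} (K : Field c ℓ) (n : ℕ) where
  open Field K
  private module PT = Presented K (Vec Word n) (TensorStep n)

  𝓦⊗ : Set c
  𝓦⊗ = PT.Comb

  infix 4 _≈𝓦⊗_
  _≈𝓦⊗_ : 𝓦⊗ → 𝓦⊗ → Set (c ⊔ ℓ)
  _≈𝓦⊗_ = PT._≋_

  φ⊗ : Vec Word n → 𝓦⊗
  φ⊗ u = (1# , u) ∷ []

{-# OPTIONS --safe #-}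
module Submission where

-- Let 𝓦 act on ℕ[x] by U = x and D = d/dx + 1, and let c_m(w) be the
-- coefficient of xᵐ in w·1.  Each c_m is a ℕ-valued linear functional on 𝓦, and
-- a word w has c_{#U w}(w) = 1, where #U w counts its letters U.  If
-- φ(u₁)⊗⋯⊗φ(uₙ) = φ(v₁)⊗⋯⊗φ(vₙ), applying c_{#U u₁} ⊗ ⋯ ⊗ c_{#U uₙ} gives
-- ∏ⱼ c_{#U uⱼ}(vⱼ) = 1 in k, hence in ℕ by characteristic 0, so every factor
-- is 1.  Contracting all slots but the i-th with these functionals is a linear
-- map 𝓦^{⊗n} → 𝓦, which therefore sends the two sides to φ(uᵢ) and φ(vᵢ).
-- Conversely, the slot embeddings 𝓦 → 𝓦^{⊗n} are linear.

open import Defs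
open import Data.Nat using (ℕ; zero; suc; _<_; s≤s)
import Data.Nat as ℕ
open import Data.Nat.Properties using (m*n≡1⇒m≡1; m*n≡1⇒n≡1)
open import Data.Fin using (Fin; zero; suc)
open import Data.Vec using (Vec; []; _∷_; lookup; map; head; tail)
open import Data.List using ([]; _∷_; _++_)
import Data.List as List
open import Data.List.Properties using (map-++)
open import Data.Product using (_,_)
open import Data.Empty using (⊥-elim)
open import Level using (_⊔_)
open import Function using (_∘_)
open import Function.Bundles using (_⇔_; mk⇔)
open import Relation.Binary.PropositionalEquality
  using (_≡_; _≗_; refl; sym; trans; cong; cong₂; subst; subst₂)

data HeadOrTail {n : ℕ} : Vec Word (suc n) → Vec Word (suc n) → Vec Word (suc n) → Set where
  here  : ∀ {w w₁ w₂ t} → WeylStep w w₁ w₂ → HeadOrTail (w ∷ t) (w₁ ∷ t) (w₂ ∷ t)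
  there : ∀ {w s s₁ s₂} → TensorStep n s s₁ s₂ → HeadOrTail (w ∷ s) (w ∷ s₁) (w ∷ s₂)

headOrTail : ∀ {n s s₁ s₂} → TensorStep (suc n) s s₁ s₂ → HeadOrTail s s₁ s₂
headOrTail (slot (w ∷ t) zero    ws) = here ws
headOrTail (slot (w ∷ t) (suc i) ws) = there (slot t i ws)

fromHeadOrTail : ∀ {n s s₁ s₂} → HeadOrTail {n} s s₁ s₂ → TensorStep (suc n) s s₁ s₂
fromHeadOrTail (here {w = w} {t = t} ws)     = slot (w ∷ t) zero ws
fromHeadOrTail (there {w = w} (slot t i ws)) = slot (w ∷ t) (suc i) ws

module PolynomialRepresentation where
  open import Data.Nat using (_+_; _*_)
  open import Data.Nat.Properties
    using (*-zeroʳ; +-identityʳ; *-identityˡ; n<1+n; m<n⇒m<1+n; *-distribˡ-+; *-distribʳ-+)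
  open import Data.Nat.Tactic.RingSolver using (solve-∀)
  open import Relation.Binary.PropositionalEquality using (module ≡-Reasoning)

  -- Polynomials as coefficient sequences.
  Poly : Set
  Poly = ℕ → ℕ

  infixl 6 _⊕_
  _⊕_ : Poly → Poly → Poly
  (p ⊕ q) m = p m + q m

  𝟙 : Poly
  𝟙 zero    = 1
  𝟙 (suc _) = 0

  mul-x : Poly → Poly
  mul-x p zero    = 0
  mul-x p (suc m) = p m

  -- The summand id makes every word act with leading coefficient 1 (act-top);
  -- d/dx alone would kill constants.
  deriv+id : Poly → Poly
  deriv+id p m = suc m * p (suc m) + p m

  ⟦_⟧ : Letter → Poly → Poly
  ⟦ D ⟧ = deriv+id
  ⟦ U ⟧ = mul-x

  act : Word → Poly → Poly
  act []      p = p
  act (l ∷ w) p = ⟦ l ⟧ (act w p)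

  ⟦⟧-cong : ∀ l {p q} → p ≗ q → ⟦ l ⟧ p ≗ ⟦ l ⟧ q
  ⟦⟧-cong D p≗q m       = cong₂ (λ a b → suc m * a + b) (p≗q (suc m)) (p≗q m)
  ⟦⟧-cong U p≗q zero    = refl
  ⟦⟧-cong U p≗q (suc m) = p≗q m

  ⟦⟧-⊕ : ∀ l p q → ⟦ l ⟧ (p ⊕ q) ≗ ⟦ l ⟧ p ⊕ ⟦ l ⟧ q
  ⟦⟧-⊕ D p q m       = interchange (suc m) (p (suc m)) (q (suc m)) (p m) (q m)
    where
    interchange : ∀ k a b c d → k * (a + b) + (c + d) ≡ (k * a + c) + (k * b + d)
    interchange = solve-∀
  ⟦⟧-⊕ U p q zero    = refl
  ⟦⟧-⊕ U p q (suc m) = refl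

  deriv+id∘mul-x : ∀ p → deriv+id (mul-x p) ≗ mul-x (deriv+id p) ⊕ p
  deriv+id∘mul-x p zero    = trans (+-identityʳ (1 * p 0)) (*-identityˡ (p 0))
  deriv+id∘mul-x p (suc m) = shuffle (suc m) (p (suc m)) (p m)
    where
    shuffle : ∀ k a b → (a + k * a) + b ≡ (k * a + b) + a
    shuffle = solve-∀

  act-cong : ∀ w {p q} → p ≗ q → act w p ≗ act w q
  act-cong []      p≗q = p≗q
  act-cong (l ∷ w) p≗q = ⟦⟧-cong l (act-cong w p≗q)

  act-⊕ : ∀ w p q → act w (p ⊕ q) ≗ act w p ⊕ act w q
  act-⊕ []      p q m = refl
  act-⊕ (l ∷ w) p q m = trans (⟦⟧-cong l (act-⊕ w p q) m) (⟦⟧-⊕ l (act w p) (act w q) m)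

  act-++ : ∀ w w′ p → act (w ++ w′) p ≗ act w (act w′ p)
  act-++ []      w′ p m = refl
  act-++ (l ∷ w) w′ p   = ⟦⟧-cong l (act-++ w w′ p)

  act-weyl : ∀ w w′ p → act (w ++ D ∷ U ∷ w′) p ≗ act (w ++ U ∷ D ∷ w′) p ⊕ act (w ++ w′) p
  act-weyl w w′ p m = begin
    act (w ++ D ∷ U ∷ w′) p m                     ≡⟨ act-++ w (D ∷ U ∷ w′) p m ⟩
    act w (deriv+id (mul-x q)) m                  ≡⟨ act-cong w (deriv+id∘mul-x q) m ⟩
    act w (mul-x (deriv+id q) ⊕ q) m              ≡⟨ act-⊕ w (mul-x (deriv+id q)) q m ⟩
    act w (mul-x (deriv+id q)) m + act w q m      ≡⟨ cong₂ _+_ (act-++ w (U ∷ D ∷ w′) p m)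
                                                               (act-++ w w′ p m) ⟨
    act (w ++ U ∷ D ∷ w′) p m + act (w ++ w′) p m ∎
    where
    open ≡-Reasoning
    q = act w′ p

  DegreeAtMost : Poly → ℕ → Set
  DegreeAtMost p k = ∀ m → k < m → p m ≡ 0

  𝟙-degree : DegreeAtMost 𝟙 0
  𝟙-degree (suc m) _ = refl

  mul-x-degree : ∀ {p k} → DegreeAtMost p k → DegreeAtMost (mul-x p) (suc k)
  mul-x-degree deg (suc m) (s≤s k<m) = deg m k<m

  deriv+id-at : ∀ p m → p (suc m) ≡ 0 → deriv+id p m ≡ p m
  deriv+id-at p m p[1+m]≡0 =
    trans (cong (λ a → suc m * a + p m) p[1+m]≡0) (cong (_+ p m) (*-zeroʳ (suc m)))

  deriv+id-degree : ∀ {p k} → DegreeAtMost p k → DegreeAtMost (deriv+id p) k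
  deriv+id-degree {p} deg m k<m =
    trans (deriv+id-at p m (deg (suc m) (m<n⇒m<1+n k<m))) (deg m k<m)

  #U : Word → ℕ
  #U []      = 0
  #U (D ∷ w) = #U w
  #U (U ∷ w) = suc (#U w)

  act-degree : ∀ w {p k} → DegreeAtMost p k → DegreeAtMost (act w p) (#U w + k)
  act-degree []      deg = deg
  act-degree (D ∷ w) deg = deriv+id-degree (act-degree w deg)
  act-degree (U ∷ w) deg = mul-x-degree (act-degree w deg)

  act-top : ∀ w {p k} → DegreeAtMost p k → act w p (#U w + k) ≡ p k
  act-top []      deg = refl
  act-top (D ∷ w) deg =
    trans (deriv+id-at (act w _) _ (act-degree w deg _ (n<1+n _))) (act-top w deg)
  act-top (U ∷ w) deg = act-top w deg

  coefficient : ℕ → Word → ℕ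
  coefficient m w = act w 𝟙 m

  coefficient-step : ∀ m {w w₁ w₂} → WeylStep w w₁ w₂ →
                     coefficient m w ≡ coefficient m w₁ + coefficient m w₂
  coefficient-step m (step w w′) = act-weyl w w′ 𝟙 m

  coefficient-#U : ∀ w → coefficient (#U w) w ≡ 1
  coefficient-#U w = subst (λ m → act w 𝟙 m ≡ 1) (+-identityʳ (#U w)) (act-top w 𝟙-degree)

  coefficient⊗ : ∀ {n} → Vec ℕ n → Vec Word n → ℕ
  coefficient⊗ []      []      = 1
  coefficient⊗ (m ∷ M) (w ∷ t) = coefficient m w * coefficient⊗ M t

  coefficient⊗-step : ∀ {n} (M : Vec ℕ n) {s s₁ s₂} → TensorStep n s s₁ s₂ →
                      coefficient⊗ M s ≡ coefficient⊗ M s₁ + coefficient⊗ M s₂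
  coefficient⊗-step []      (slot _ () _)
  coefficient⊗-step (m ∷ M) ts with headOrTail ts
  ... | here {w₁ = w₁} {w₂} {t} ws =
    trans (cong (_* coefficient⊗ M t) (coefficient-step m ws))
          (*-distribʳ-+ (coefficient⊗ M t) (coefficient m w₁) (coefficient m w₂))
  ... | there {w = w} {s₁ = s₁} {s₂} ts =
    trans (cong (coefficient m w *_) (coefficient⊗-step M ts))
          (*-distribˡ-+ (coefficient m w) (coefficient⊗ M s₁) (coefficient⊗ M s₂))

  coefficient⊗-#U : ∀ {n} (t : Vec Word n) → coefficient⊗ (map #U t) t ≡ 1
  coefficient⊗-#U []      = refl
  coefficient⊗-#U (w ∷ t) = cong₂ _*_ (coefficient-#U w) (coefficient⊗-#U t)

open PolynomialRepresentation
  using (#U; coefficient; coefficient-step; coefficient-#U;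
         coefficient⊗; coefficient⊗-step; coefficient⊗-#U)

module _ {c ℓ} (K : Field c ℓ) where
  open Field K hiding (zero) renaming (refl to ≈-refl; sym to ≈-sym; trans to ≈-trans)
  open import Algebra.Properties.Group +-group using () renaming (∙-cancelˡ to +-cancelˡ)
  open import Algebra.Properties.CommutativeSemigroup +-commutativeSemigroup
    using () renaming (x∙yz≈y∙xz to x+[y+z]≈y+[x+z])

  ι : ℕ → Carrier
  ι = fromℕ commutativeRing

  ι-+ : ∀ m n → ι (m ℕ.+ n) ≈ ι m + ι n
  ι-+ zero    n = ≈-sym (+-identityˡ (ι n))
  ι-+ (suc m) n = ≈-trans (+-congˡ (ι-+ m n)) (≈-sym (+-assoc 1# (ι m) (ι n)))

  ι-injective : ∀ {m n} → ι m ≈ ι n → m ≡ n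
  ι-injective {zero}  {zero}  _  = refl
  ι-injective {zero}  {suc n} eq = ⊥-elim (char0 n (≈-sym eq))
  ι-injective {suc m} {zero}  eq = ⊥-elim (char0 m eq)
  ι-injective {suc m} {suc n} eq = cong suc (ι-injective (+-cancelˡ 1# (ι m) (ι n) eq))

  module Functional {b r} {B : Set b} {R : B → B → B → Set r} (ω : B → ℕ)
                    (ω-step : ∀ {t t₁ t₂} → R t t₁ t₂ → ω t ≡ ω t₁ ℕ.+ ω t₂) where
    open Presented K B R

    evaluate : Comb → Carrier
    evaluate []             = 0#
    evaluate ((a , t) ∷ xs) = a * ι (ω t) + evaluate xs

    evaluate-++ : ∀ xs ys → evaluate (xs ++ ys) ≈ evaluate xs + evaluate ys
    evaluate-++ []             ys = ≈-sym (+-identityˡ (evaluate ys))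
    evaluate-++ ((a , t) ∷ xs) ys =
      ≈-trans (+-congˡ (evaluate-++ xs ys))
              (≈-sym (+-assoc (a * ι (ω t)) (evaluate xs) (evaluate ys)))

    evaluate-cong : ∀ {xs ys} → xs ≋ ys → evaluate xs ≈ evaluate ys
    evaluate-cong ≋-refl           = ≈-refl
    evaluate-cong (≋-sym eq)       = ≈-sym (evaluate-cong eq)
    evaluate-cong (≋-trans eq eq′) = ≈-trans (evaluate-cong eq) (evaluate-cong eq′)
    evaluate-cong (++-cong {xs} {xs′} {ys} {ys′} eq eq′) =
      ≈-trans (evaluate-++ xs ys)
        (≈-trans (+-cong (evaluate-cong eq) (evaluate-cong eq′)) (≈-sym (evaluate-++ xs′ ys′)))
    evaluate-cong (swap {a} {a′} {t} {t′} {xs}) =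
      x+[y+z]≈y+[x+z] (a * ι (ω t)) (a′ * ι (ω t′)) (evaluate xs)
    evaluate-cong (merge {a} {a′} {t} {xs}) =
      ≈-trans (≈-sym (+-assoc (a * ι (ω t)) (a′ * ι (ω t)) (evaluate xs)))
              (+-congʳ (≈-sym (distribʳ (ι (ω t)) a a′)))
    evaluate-cong (zero-c {t} {xs}) =
      ≈-trans (+-congʳ (zeroˡ (ι (ω t)))) (+-identityˡ (evaluate xs))
    evaluate-cong (coeff a≈a′) = +-congʳ (*-congʳ a≈a′)
    evaluate-cong (rel {a} {t} {t₁} {t₂} {xs} r) =
      ≈-trans (+-congʳ (≈-trans (*-congˡ ι-step) (distribˡ a (ι (ω t₁)) (ι (ω t₂)))))
              (+-assoc (a * ι (ω t₁)) (a * ι (ω t₂)) (evaluate xs))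
      where
      ι-step : ι (ω t) ≈ ι (ω t₁) + ι (ω t₂)
      ι-step = ≈-trans (reflexive (cong ι (ω-step r))) (ι-+ (ω t₁) (ω t₂))

    evaluate-basis : ∀ {x y} → (1# , x) ∷ [] ≋ (1# , y) ∷ [] → ω x ≡ ω y
    evaluate-basis {x} {y} eq =
      ι-injective (≈-trans (≈-sym (unit x)) (≈-trans (evaluate-cong eq) (unit y)))
      where
      unit : ∀ t → 1# * ι (ω t) + 0# ≈ ι (ω t)
      unit t = ≈-trans (+-identityʳ (1# * ι (ω t))) (*-identityˡ (ι (ω t)))

  -- The two ways in which t ↦ ω t · f t can respect a relation t = t₁ + t₂.
  data Respects {b b′ r′} {B : Set b} {B′ : Set b′} (R′ : B′ → B′ → B′ → Set r′)
                (f : B → B′) (ω : B → ℕ) (t t₁ t₂ : B) : Set (b′ ⊔ r′) where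
    preserved : ω t ≡ ω t₁ → ω t ≡ ω t₂ → R′ (f t) (f t₁) (f t₂) → Respects R′ f ω t t₁ t₂
    collapsed : f t₁ ≡ f t → f t₂ ≡ f t → ω t ≡ ω t₁ ℕ.+ ω t₂ → Respects R′ f ω t t₁ t₂

  module BasisMap {b b′ r r′} {B : Set b} {B′ : Set b′}
                  {R : B → B → B → Set r} {R′ : B′ → B′ → B′ → Set r′}
                  (f : B → B′) (ω : B → ℕ)
                  (respects : ∀ {t t₁ t₂} → R t t₁ t₂ → Respects R′ f ω t t₁ t₂) where
    private module S = Presented K B R
    open Presented K B′ R′

    image : S.Comb → Comb
    image = List.map λ (a , t) → (a * ι (ω t) , f t)

    image-cong : ∀ {xs ys} → xs S.≋ ys → image xs ≋ image ys
    image-cong S.≋-refl           = ≋-refl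
    image-cong (S.≋-sym eq)       = ≋-sym (image-cong eq)
    image-cong (S.≋-trans eq eq′) = ≋-trans (image-cong eq) (image-cong eq′)
    image-cong (S.++-cong {xs} {xs′} {ys} {ys′} eq eq′) =
      subst₂ _≋_ (sym (map-++ _ xs ys)) (sym (map-++ _ xs′ ys′))
                 (++-cong (image-cong eq) (image-cong eq′))
    image-cong S.swap         = swap
    image-cong S.merge        = ≋-trans merge (coeff (≈-sym (distribʳ _ _ _)))
    image-cong S.zero-c       = ≋-trans (coeff (zeroˡ _)) zero-c
    image-cong (S.coeff a≈a′) = coeff (*-congʳ a≈a′)
    image-cong (S.rel {a} {t} {t₁} {t₂} r) with respects r
    ... | preserved ω₁ ω₂ r′ rewrite ω₁ | ω₂ = rel r′
    ... | collapsed f₁ f₂ ω-step rewrite f₁ | f₂ | ω-step =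
      ≋-trans (coeff (≈-trans (*-congˡ (ι-+ (ω t₁) (ω t₂))) (distribˡ a (ι (ω t₁)) (ι (ω t₂)))))
              (≋-sym merge)

    image-basis : ∀ {x y} → ω x ≡ 1 → ω y ≡ 1 →
                  (1# , x) ∷ [] S.≋ (1# , y) ∷ [] → (1# , f x) ∷ [] ≋ (1# , f y) ∷ []
    image-basis ωx≡1 ωy≡1 eq =
      ≋-trans (coeff (≈-sym (unit ωx≡1))) (≋-trans (image-cong eq) (coeff (unit ωy≡1)))
      where
      unit : ∀ {t} → ω t ≡ 1 → 1# * ι (ω t) ≈ 1#
      unit ωt≡1 rewrite ωt≡1 = ≈-trans (*-identityˡ (1# + 0#)) (+-identityʳ 1#)

  basis-map-cong : ∀ {b b′ r r′} {B : Set b} {B′ : Set b′}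
                   {R : B → B → B → Set r} {R′ : B′ → B′ → B′ → Set r′}
                   (f : B → B′) → (∀ {t t₁ t₂} → R t t₁ t₂ → R′ (f t) (f t₁) (f t₂)) →
                   ∀ {x y} →
                   Presented._≋_ K B R ((1# , x) ∷ []) ((1# , y) ∷ []) →
                   Presented._≋_ K B′ R′ ((1# , f x) ∷ []) ((1# , f y) ∷ [])
  basis-map-cong f f-step =
    BasisMap.image-basis f (λ _ → 1) (λ r → preserved refl refl (f-step r)) refl refl

  infix 4 _≈φ_ _≈φ⊗_
  _≈φ_ : Word → Word → Set (c ⊔ ℓ)
  x ≈φ y = _≈𝓦_ K (φ K x) (φ K y)

  _≈φ⊗_ : ∀ {n} → Vec Word n → Vec Word n → Set (c ⊔ ℓ)
  u ≈φ⊗ v = _≈𝓦⊗_ K _ (φ⊗ K _ u) (φ⊗ K _ v)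

  ≈φ⊗⇒coefficient⊗≡ : ∀ {n} (M : Vec ℕ n) {s s′ : Vec Word n} → s ≈φ⊗ s′ →
                      coefficient⊗ M s ≡ coefficient⊗ M s′
  ≈φ⊗⇒coefficient⊗≡ M = Functional.evaluate-basis (coefficient⊗ M) (coefficient⊗-step M)

  ≈φ⊗⇒coefficient⊗-#U≡1 : ∀ {n} {u v : Vec Word n} → u ≈φ⊗ v → coefficient⊗ (map #U u) v ≡ 1
  ≈φ⊗⇒coefficient⊗-#U≡1 {u = u} eq =
    trans (sym (≈φ⊗⇒coefficient⊗≡ (map #U u) eq)) (coefficient⊗-#U u)

  ≈φ⊗⇒head≈φ : ∀ {n x y} {u v : Vec Word n} → x ∷ u ≈φ⊗ y ∷ v → x ≈φ y
  ≈φ⊗⇒head≈φ {n} {x} {y} {u} {v} eq = BasisMap.image-basis head ω project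
    (coefficient⊗-#U u) (m*n≡1⇒n≡1 (coefficient (#U x) y) _ (≈φ⊗⇒coefficient⊗-#U≡1 eq)) eq
    where
    ω : Vec Word (suc n) → ℕ
    ω = coefficient⊗ (map #U u) ∘ tail
    project : ∀ {s s₁ s₂} → TensorStep (suc n) s s₁ s₂ → Respects WeylStep head ω s s₁ s₂
    project ts with headOrTail ts
    ... | here ws   = preserved refl refl ws
    ... | there ts′ = collapsed refl refl (coefficient⊗-step (map #U u) ts′)

  ≈φ⊗⇒tail≈φ⊗ : ∀ {n x y} {u v : Vec Word n} → x ∷ u ≈φ⊗ y ∷ v → u ≈φ⊗ v
  ≈φ⊗⇒tail≈φ⊗ {n} {x} {y} {u} {v} eq = BasisMap.image-basis tail ω project
    (coefficient-#U x) (m*n≡1⇒m≡1 _ (coefficient⊗ (map #U u) v) (≈φ⊗⇒coefficient⊗-#U≡1 eq)) eq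
    where
    ω : Vec Word (suc n) → ℕ
    ω = coefficient (#U x) ∘ head
    project : ∀ {s s₁ s₂} → TensorStep (suc n) s s₁ s₂ → Respects (TensorStep n) tail ω s s₁ s₂
    project ts with headOrTail ts
    ... | here ws   = collapsed refl refl (coefficient-step (#U x) ws)
    ... | there ts′ = preserved refl refl ts′

  ≈φ⊗⇒slotwise≈φ : ∀ n (u v : Vec Word n) → u ≈φ⊗ v → ∀ i → lookup u i ≈φ lookup v i
  ≈φ⊗⇒slotwise≈φ (suc n) (x ∷ u) (y ∷ v) eq zero    = ≈φ⊗⇒head≈φ eq
  ≈φ⊗⇒slotwise≈φ (suc n) (x ∷ u) (y ∷ v) eq (suc i) = ≈φ⊗⇒slotwise≈φ n u v (≈φ⊗⇒tail≈φ⊗ eq) i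

  slotwise≈φ⇒≈φ⊗ : ∀ n (u v : Vec Word n) → (∀ i → lookup u i ≈φ lookup v i) → u ≈φ⊗ v
  slotwise≈φ⇒≈φ⊗ zero    []      []      _   = Presented.≋-refl
  slotwise≈φ⇒≈φ⊗ (suc n) (x ∷ u) (y ∷ v) eqs = Presented.≋-trans
    (basis-map-cong (x ∷_) (λ ts → fromHeadOrTail (there ts)) (slotwise≈φ⇒≈φ⊗ n u v (eqs ∘ suc)))
    (basis-map-cong (_∷ v) (λ ws → fromHeadOrTail (here ws)) (eqs zero))

theorem10p1 : ∀ {c ℓ} (K : Field c ℓ) (n : ℕ) (u v : Vec Word n) →
    _≈𝓦⊗_ K n (φ⊗ K n u) (φ⊗ K n v) ⇔ (∀ (i : Fin n) → _≈𝓦_ K (φ K (lookup u i)) (φ K (lookup v i)))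
theorem10p1 K n u v = mk⇔ (≈φ⊗⇒slotwise≈φ K n u v) (slotwise≈φ⇒≈φ⊗ K n u v)
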